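{- Let $k\ge3$ and let $w_0,\dots,w_{k-1}$ be real numbers such that $g_0(x)=\mathrm{sgn}\big(\sum_{i=0}^{k-1}w_iL_i(x)\big)$ for all $x\in\{ -1,1\}^k$. Then $w_0<0$, $w_j>0$ for $j=1,\dots,k-1$, and $w_{j-1}>w_j$ for $j=2,\dots,k-1$.
   Context: $\mathrm{sgn}(t)=1$ if $t\ge0$ and $-1$ otherwise. For $x\in\{ -1,1\}^k$, $L_0(x)=x_1+x_k$ and $L_j(x)=x_j-x_{j+1}$ for $j=1,\dots,k-1$. The function $g_0\colon\{ -1,1\}^k\to\{ -1,1\}$ is defined by $g_0(x)=x_1$ if the bits $x_1,\dots,x_k$ are not all equal and $g_0(x)=-x_1$ if they are all equal. -}

module Defs where

open import Level using (Level; _⊔_)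
open import Data.Nat as ℕ using (ℕ; zero; suc)
open import Data.Fin using (Fin; zero; suc; fromℕ; inject₁)
open import Data.Sign using (Sign; opposite) renaming (+ to ⊕; - to ⊖)
open import Data.Product using (_×_)
open import Data.Unit using (⊤)
open import Relation.Nullary using (¬_)
open import Relation.Binary.PropositionalEquality using (_≡_)
open import Relation.Binary.Structures using (IsTotalOrder)
open import Algebra.Structures using (IsCommutativeRing)

-- The paper's
-- weights are reals; we state the result for weights in an arbitrary
-- ordered commutative ring, which in particular covers ℝ.
record OrderedCommRing (c ℓ : Level) : Set (Level.suc (c ⊔ ℓ)) where
  infixl 6 _+_
  infixl 7 _*_
  infix 4 _≤_
  field
    Carrier : Set c
    _+_ _*_ : Carrier → Carrier → Carrier
    -_ : Carrier → Carrier
    0# 1# : Carrier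
    _≤_ : Carrier → Carrier → Set ℓ
    isCommutativeRing : IsCommutativeRing _≡_ _+_ _*_ -_ 0# 1#
    isTotalOrder : IsTotalOrder _≡_ _≤_
    +-mono-≤ : ∀ {x y} z → x ≤ y → x + z ≤ y + z
    *-nonneg : ∀ {x y} → 0# ≤ x → 0# ≤ y → 0# ≤ x * y
    0≢1 : ¬ (0# ≡ 1#)

  infix 4 _<_
  _<_ : Carrier → Carrier → Set (c ⊔ ℓ)
  x < y = (x ≤ y) × ¬ (x ≡ y)

  _-_ : Carrier → Carrier → Carrier
  x - y = x + (- y)

module _ {c ℓ : Level} (R : OrderedCommRing c ℓ) where
  open OrderedCommRing R

  ⟦_⟧ : Sign → Carrier
  ⟦ ⊕ ⟧ = 1#
  ⟦ ⊖ ⟧ = - 1#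

  -- sgn(t) = s, with sgn(t) = 1 iff t ≥ 0 and -1 otherwise
  SgnIs : Carrier → Sign → Set (c ⊔ ℓ)
  SgnIs t ⊕ = Level.Lift (c ⊔ ℓ) (0# ≤ t)
  SgnIs t ⊖ = t < 0#

  sumF : (k : ℕ) → (Fin k → Carrier) → Carrier
  sumF zero f = 0#
  sumF (suc k) f = f zero + sumF k (λ i → f (suc i))

  -- x ∈ {-1,1}^k is a function Fin k → Sign, x_j (1-based) = x (j-1).
  -- L_0(x) = x_1 + x_k ;  L_j(x) = x_j - x_{j+1} for j = 1..k-1
  -- (index i : Fin k stands for L_i, i = 0..k-1).
  L : (k : ℕ) → (Fin k → Sign) → Fin k → Carrier
  L (suc m) x zero    = ⟦ x zero ⟧ + ⟦ x (fromℕ m) ⟧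
  L (suc m) x (suc j) = ⟦ x (inject₁ j) ⟧ - ⟦ x (suc j) ⟧

AllEqual : {k : ℕ} → (Fin k → Sign) → Set
AllEqual x = ∀ i j → x i ≡ x j

-- g0(x) = s : g0 x = x_1 if not all bits equal, -x_1 if all equal
-- (k = 0 is vacuous: there is no x_1; the theorem assumes k ≥ 3)
G0Is : (k : ℕ) → (Fin k → Sign) → Sign → Set
G0Is zero x s = ⊤
G0Is (suc m) x s = (AllEqual x → s ≡ opposite (x zero)) × (¬ AllEqual x → s ≡ x zero)

module Submission where

-- Each inequality comes from evaluating the representation at one test vector
-- x with g₀(x) = -1, so that the score  S(x) = Σᵢ wᵢ Lᵢ(x)  must be negative:
--   * x = (1,…,1) is constant, g₀(x) = -1 and S(x) = 2w₀, hence w₀ < 0;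
--   * x = (-1,…,-1,1,…,1) with a single sign change after position j has
--     L₀(x) = 0 and a single nonzero Lᵢ(x), namely Lⱼ(x) = -2, so S(x) = -2wⱼ;
--   * x = (-1,…,-1,1,-1,…,-1) with its only +1 at position j has
--     S(x) = -2w₀ - 2w_{j-1} + 2wⱼ, and -2w₀ > 0 by the first item.

open import Defs
open import Data.Nat as ℕ using (ℕ; zero; suc; s≤s)
import Data.Nat.Properties as ℕₚ
open import Data.Fin using (Fin; zero; suc; toℕ)
open import Data.Fin.Properties
  using (toℕ<n; toℕ-injective; toℕ-fromℕ; toℕ-inject₁) renaming (suc-injective to Fin-suc-injective)
open import Data.Sign using (Sign; opposite) renaming (+ to ⊕; - to ⊖)
open import Data.Product using (_×_; _,_; proj₁; proj₂)
open import Data.Sum using (inj₁; inj₂)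
open import Function using (_∘_)
open import Relation.Nullary using (¬_; contradiction)
open import Relation.Binary.PropositionalEquality
open import Relation.Binary.Structures using (IsTotalOrder)
open import Algebra.Structures using (IsCommutativeRing)
open import Algebra.Bundles using (CommutativeRing)
import Algebra.Properties.Ring as RingProperties
import Algebra.Properties.CommutativeSemigroup as CommutativeSemigroupProperties

step : ℕ → ℕ → Sign
step t       zero    = ⊖
step zero    (suc u) = ⊕
step (suc t) (suc u) = step t u

step-≤ : ∀ {t u} → u ℕ.≤ t → step t u ≡ ⊖
step-≤ {t}     {zero}  _       = refl
step-≤ {suc t} {suc u} (s≤s h) = step-≤ h

step-> : ∀ {t u} → t ℕ.< u → step t u ≡ ⊕
step-> {zero}  {suc u} _       = refl
step-> {suc t} {suc u} (s≤s h) = step-> h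

step-flat : ∀ {t u} → u ≢ t → step t u ≡ step t (suc u)
step-flat {zero}  {zero}  u≢t = contradiction refl u≢t
step-flat {zero}  {suc u} _   = refl
step-flat {suc t} {zero}  _   = refl
step-flat {suc t} {suc u} u≢t = step-flat (u≢t ∘ cong suc)

spike : ℕ → ℕ → Sign
spike zero    zero    = ⊕
spike zero    (suc u) = ⊖
spike (suc p) zero    = ⊖
spike (suc p) (suc u) = spike p u

spike-at : ∀ p → spike p p ≡ ⊕
spike-at zero    = refl
spike-at (suc p) = spike-at p

spike-off : ∀ {p u} → u ≢ p → spike p u ≡ ⊖
spike-off {zero}  {zero}  u≢p = contradiction refl u≢p
spike-off {zero}  {suc u} _   = refl
spike-off {suc p} {zero}  _   = refl
spike-off {suc p} {suc u} u≢p = spike-off (u≢p ∘ cong suc)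

g₀-nonconstant : ∀ {m} (x : Fin (suc m) → Sign) (q : Fin (suc m)) →
                 x zero ≡ ⊖ → x q ≡ ⊕ → G0Is (suc m) x ⊖
g₀-nonconstant x q x₁≡⊖ xq≡⊕ =
  (λ allEqual → contradiction (trans (sym x₁≡⊖) (trans (allEqual zero q) xq≡⊕)) λ ())
  , λ _ → sym x₁≡⊖

g₀-constant : ∀ {m} → G0Is (suc m) (λ _ → ⊕) ⊖
g₀-constant = (λ _ → refl) , λ notAllEqual → contradiction (λ _ _ → refl) notAllEqual

module Arithmetic {c ℓ} (R : OrderedCommRing c ℓ) where
  open OrderedCommRing R
  open IsCommutativeRing isCommutativeRing
    using (+-assoc; +-comm; +-identityˡ; +-identityʳ; -‿inverseˡ; -‿inverseʳ; distribˡ; *-identityʳ)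
  open IsTotalOrder isTotalOrder using (antisym; total) renaming (trans to ≤-trans)

  commutativeRing : CommutativeRing c c
  commutativeRing = record { isCommutativeRing = isCommutativeRing }

  open RingProperties (CommutativeRing.ring commutativeRing)
    using (-‿involutive; -0#≈0#; -‿distribʳ-*)
  open CommutativeSemigroupProperties (CommutativeRing.+-commutativeSemigroup commutativeRing)
    using (interchange)

  infixl 7 _⊛_
  _⊛_ : Carrier → Sign → Carrier
  a ⊛ ⊕ = a
  a ⊛ ⊖ = - a

  *-sign : ∀ a s → a * ⟦_⟧ R s ≡ a ⊛ s
  *-sign a ⊕ = *-identityʳ a
  *-sign a ⊖ = trans (sym (-‿distribʳ-* a 1#)) (cong -_ (*-identityʳ a))

  sign-opposite : ∀ s → ⟦_⟧ R (opposite s) ≡ - ⟦_⟧ R s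
  sign-opposite ⊕ = refl
  sign-opposite ⊖ = sym (-‿involutive 1#)

  *-sign-sum : ∀ a s t → a * (⟦_⟧ R s + ⟦_⟧ R t) ≡ a ⊛ s + a ⊛ t
  *-sign-sum a s t = trans (distribˡ a _ _) (cong₂ _+_ (*-sign a s) (*-sign a t))

  jump : Carrier → Sign → Sign → Carrier
  jump a s t = a ⊛ s + a ⊛ opposite t

  *-sign-diff : ∀ a s t → a * (⟦_⟧ R s - ⟦_⟧ R t) ≡ jump a s t
  *-sign-diff a s t =
    trans (cong (λ z → a * (⟦_⟧ R s + z)) (sym (sign-opposite t))) (*-sign-sum a s (opposite t))

  jump-flat : ∀ a {s t} → s ≡ t → jump a s t ≡ 0#
  jump-flat a {⊕} refl = -‿inverseʳ a
  jump-flat a {⊖} refl = -‿inverseˡ a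

  <⇒≱ : ∀ {a b} → a < b → ¬ (b ≤ a)
  <⇒≱ (a≤b , a≢b) b≤a = a≢b (antisym a≤b b≤a)

  +-nonneg : ∀ {a b} → 0# ≤ a → 0# ≤ b → 0# ≤ a + b
  +-nonneg {a} {b} 0≤a 0≤b = ≤-trans 0≤b (subst (_≤ a + b) (+-identityˡ b) (+-mono-≤ b 0≤a))

  -‿nonneg : ∀ {a} → a ≤ 0# → 0# ≤ - a
  -‿nonneg {a} a≤0 = subst₂ _≤_ (-‿inverseʳ a) (+-identityˡ (- a)) (+-mono-≤ (- a) a≤0)

  half-neg : ∀ {a} → a + a < 0# → a < 0#
  half-neg {a} 2a<0 with total a 0#
  ... | inj₁ a≤0 = a≤0 , λ a≡0 → proj₂ 2a<0 (trans (cong₂ _+_ a≡0 a≡0) (+-identityˡ 0#))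
  ... | inj₂ 0≤a = contradiction (+-nonneg 0≤a 0≤a) (<⇒≱ 2a<0)

  -‿neg⇒pos : ∀ {a} → - a < 0# → 0# < a
  -‿neg⇒pos {a} (-a≤0 , -a≢0) =
    subst (0# ≤_) (-‿involutive a) (-‿nonneg -a≤0) ,
    λ 0≡a → -a≢0 (trans (cong -_ (sym 0≡a)) -0#≈0#)

  nonneg+neg : ∀ {a b} → 0# ≤ a → a + b < 0# → b < 0#
  nonneg+neg {a} {b} 0≤a a+b<0 with total b 0#
  ... | inj₁ b≤0 = b≤0 , λ b≡0 → <⇒≱ a+b<0 (subst (0# ≤_) (sym (trans (cong (a +_) b≡0) (+-identityʳ a))) 0≤a)
  ... | inj₂ 0≤b = contradiction (+-nonneg 0≤a 0≤b) (<⇒≱ a+b<0)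

  diff-neg : ∀ {a b} → b - a < 0# → b < a
  diff-neg {a} {b} (b-a≤0 , b-a≢0) =
    subst₂ _≤_ b-a+a≡b (+-identityˡ a) (+-mono-≤ a b-a≤0) ,
    λ b≡a → b-a≢0 (trans (cong (_- a) b≡a) (-‿inverseʳ a))
    where
    b-a+a≡b : b - a + a ≡ b
    b-a+a≡b = trans (+-assoc b (- a) a) (trans (cong (b +_) (-‿inverseˡ a)) (+-identityʳ b))

  double-diff-neg : ∀ {a b} → (- a + - a) + (b + b) < 0# → b < a
  double-diff-neg {a} {b} h = diff-neg (half-neg (subst (_< 0#) rearrange h))
    where
    rearrange : (- a + - a) + (b + b) ≡ (b - a) + (b - a)
    rearrange = trans (+-comm (- a + - a) (b + b)) (interchange b b (- a) (- a))

  sumF-cong : ∀ n {f g : Fin n → Carrier} → (∀ i → f i ≡ g i) → sumF R n f ≡ sumF R n g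
  sumF-cong zero    f≗g = refl
  sumF-cong (suc n) f≗g = cong₂ _+_ (f≗g zero) (sumF-cong n (f≗g ∘ suc))

  sumF-zero : ∀ n (f : Fin n → Carrier) → (∀ i → f i ≡ 0#) → sumF R n f ≡ 0#
  sumF-zero zero    f f≡0 = refl
  sumF-zero (suc n) f f≡0 =
    trans (cong₂ _+_ (f≡0 zero) (sumF-zero n (f ∘ suc) (f≡0 ∘ suc))) (+-identityˡ 0#)

  sumF-single : ∀ n (f : Fin n → Carrier) (q : Fin n) →
                (∀ i → i ≢ q → f i ≡ 0#) → sumF R n f ≡ f q
  sumF-single (suc n) f zero    off =
    trans (cong (f zero +_) (sumF-zero n (f ∘ suc) (λ i → off (suc i) λ ()))) (+-identityʳ _)
  sumF-single (suc n) f (suc q) off =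
    trans (cong₂ _+_ (off zero λ ())
                     (sumF-single n (f ∘ suc) q (λ i i≢q → off (suc i) (i≢q ∘ Fin-suc-injective))))
          (+-identityˡ _)

  sumF-pair : ∀ n (f : Fin n → Carrier) (q r : Fin n) → q ≢ r →
              (∀ i → i ≢ q → i ≢ r → f i ≡ 0#) → sumF R n f ≡ f q + f r
  sumF-pair (suc n) f zero    zero    q≢r off = contradiction refl q≢r
  sumF-pair (suc n) f zero    (suc r) q≢r off =
    cong (f zero +_) (sumF-single n (f ∘ suc) r (λ i i≢r → off (suc i) (λ ()) (i≢r ∘ Fin-suc-injective)))
  sumF-pair (suc n) f (suc q) zero    q≢r off =
    trans (cong (f zero +_)
                (sumF-single n (f ∘ suc) q (λ i i≢q → off (suc i) (i≢q ∘ Fin-suc-injective) (λ ()))))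
          (+-comm _ _)
  sumF-pair (suc n) f (suc q) (suc r) q≢r off =
    trans (cong₂ _+_ (off zero (λ ()) (λ ()))
                     (sumF-pair n (f ∘ suc) q r (q≢r ∘ cong suc)
                        (λ i i≢q i≢r → off (suc i) (i≢q ∘ Fin-suc-injective) (i≢r ∘ Fin-suc-injective))))
          (+-identityˡ _)

module Score {c ℓ} (R : OrderedCommRing c ℓ) (m : ℕ)
             (w : Fin (suc m) → OrderedCommRing.Carrier R) where
  open OrderedCommRing R
  open Arithmetic R

  score : (Fin (suc m) → Sign) → Carrier
  score x = sumF R (suc m) (λ i → w i * L R (suc m) x i)

  boundary : (ℕ → Sign) → Carrier
  boundary φ = w zero ⊛ φ 0 + w zero ⊛ φ m

  jumpAt : (ℕ → Sign) → Fin m → Carrier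
  jumpAt φ j = jump (w (suc j)) (φ (toℕ j)) (φ (suc (toℕ j)))

  score-profile : ∀ φ → score (φ ∘ toℕ) ≡ boundary φ + sumF R m (jumpAt φ)
  score-profile φ = cong₂ _+_ boundary-term (sumF-cong m jump-term)
    where
    boundary-term : w zero * L R (suc m) (φ ∘ toℕ) zero ≡ boundary φ
    boundary-term =
      trans (cong (λ n → w zero * (⟦_⟧ R (φ 0) + ⟦_⟧ R (φ n))) (toℕ-fromℕ m)) (*-sign-sum (w zero) (φ 0) (φ m))
    jump-term : ∀ j → w (suc j) * L R (suc m) (φ ∘ toℕ) (suc j) ≡ jumpAt φ j
    jump-term j =
      trans (cong (λ n → w (suc j) * (⟦_⟧ R (φ n) - ⟦_⟧ R (φ (suc (toℕ j))))) (toℕ-inject₁ j))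
            (*-sign-diff (w (suc j)) (φ (toℕ j)) (φ (suc (toℕ j))))

module Weights {c ℓ} (R : OrderedCommRing c ℓ) (m : ℕ)
               (w : Fin (suc m) → OrderedCommRing.Carrier R)
               (represents : ∀ (x : Fin (suc m) → Sign) (s : Sign) → G0Is (suc m) x s →
                  SgnIs R (sumF R (suc m) (λ i → OrderedCommRing._*_ R (w i) (L R (suc m) x i))) s)
               where
  open OrderedCommRing R
  open IsCommutativeRing isCommutativeRing using (+-identityˡ; +-identityʳ; -‿inverseˡ)
  open Arithmetic R
  open Score R m w
  open ≡-Reasoning

  negative-score : ∀ x → G0Is (suc m) x ⊖ → score x < 0#
  negative-score x = represents x ⊖

  w₀-negative : w zero < 0#
  w₀-negative = half-neg (subst (_< 0#) constant-score (negative-score (λ _ → ⊕) g₀-constant))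
    where
    no-jump : ∀ j → jumpAt (λ _ → ⊕) j ≡ 0#
    no-jump j = jump-flat (w (suc j)) refl
    constant-score : score (λ _ → ⊕) ≡ w zero + w zero
    constant-score = begin
      score (λ _ → ⊕)                                  ≡⟨ score-profile (λ _ → ⊕) ⟩
      boundary (λ _ → ⊕) + sumF R m (jumpAt (λ _ → ⊕)) ≡⟨ cong (boundary (λ _ → ⊕) +_)
                                                              (sumF-zero m (jumpAt (λ _ → ⊕)) no-jump) ⟩
      (w zero + w zero) + 0#                           ≡⟨ +-identityʳ _ ⟩
      w zero + w zero                                  ∎

  wⱼ-positive : ∀ (j : Fin m) → 0# < w (suc j)
  wⱼ-positive j = -‿neg⇒pos (half-neg (subst (_< 0#) step-score
    (negative-score (φ ∘ toℕ) (g₀-nonconstant (φ ∘ toℕ) (suc j) refl (step-> (ℕₚ.n<1+n t))))))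
    where
    t = toℕ j
    φ = step t
    flat : ∀ i → i ≢ j → jumpAt φ i ≡ 0#
    flat i i≢j = jump-flat _ (step-flat (i≢j ∘ toℕ-injective))
    step-score : score (φ ∘ toℕ) ≡ - w (suc j) + - w (suc j)
    step-score = begin
      score (φ ∘ toℕ)                    ≡⟨ score-profile φ ⟩
      boundary φ + sumF R m (jumpAt φ)   ≡⟨ cong₂ _+_ (cong (λ s → - w zero + w zero ⊛ s) (step-> (toℕ<n j)))
                                                      (sumF-single m (jumpAt φ) j flat) ⟩
      (- w zero + w zero) + jumpAt φ j   ≡⟨ cong₂ _+_ (-‿inverseˡ (w zero))
                                                      (cong₂ (jump (w (suc j))) (step-≤ {t} ℕₚ.≤-refl) (step-> (ℕₚ.n<1+n t))) ⟩
      0# + (- w (suc j) + - w (suc j))   ≡⟨ +-identityˡ _ ⟩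
      - w (suc j) + - w (suc j)          ∎

  wⱼ-decreasing : ∀ (i j : Fin m) → toℕ j ≡ suc (toℕ i) → w (suc j) < w (suc i)
  wⱼ-decreasing i j j≡p = double-diff-neg (nonneg+neg (+-nonneg -w₀≥0 -w₀≥0) (subst (_< 0#) spike-score
    (negative-score (φ ∘ toℕ) (g₀-nonconstant (φ ∘ toℕ) (suc i) refl (spike-at p)))))
    where
    p = suc (toℕ i)
    φ = spike p
    -w₀≥0 : 0# ≤ - w zero
    -w₀≥0 = -‿nonneg (proj₁ w₀-negative)
    m≢p : m ≢ p
    m≢p m≡p = ℕₚ.<⇒≢ (toℕ<n j) (trans j≡p (sym m≡p))
    i≢j : i ≢ j
    i≢j i≡j = ℕₚ.1+n≢n (sym (trans (cong toℕ i≡j) j≡p))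
    flat : ∀ k → k ≢ i → k ≢ j → jumpAt φ k ≡ 0#
    flat k k≢i k≢j = jump-flat _ (trans (spike-off k≢p) (sym (spike-off k+1≢p)))
      where
      k≢p : toℕ k ≢ p
      k≢p k≡p = k≢j (toℕ-injective (trans k≡p (sym j≡p)))
      k+1≢p : suc (toℕ k) ≢ p
      k+1≢p k+1≡p = k≢i (toℕ-injective (ℕₚ.suc-injective k+1≡p))
    rise : jumpAt φ i ≡ - w (suc i) + - w (suc i)
    rise = cong₂ (jump (w (suc i))) (spike-off {u = toℕ i} (ℕₚ.1+n≢n ∘ sym)) (spike-at p)
    fall : jumpAt φ j ≡ w (suc j) + w (suc j)
    fall = cong₂ (jump (w (suc j))) (trans (cong φ j≡p) (spike-at p))
                          (spike-off (ℕₚ.1+n≢n ∘ trans (cong suc (sym j≡p))))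
    spike-score : score (φ ∘ toℕ) ≡ (- w zero + - w zero) + ((- w (suc i) + - w (suc i)) + (w (suc j) + w (suc j)))
    spike-score = begin
      score (φ ∘ toℕ)                                  ≡⟨ score-profile φ ⟩
      boundary φ + sumF R m (jumpAt φ)                 ≡⟨ cong₂ _+_ (cong (λ s → - w zero + w zero ⊛ s) (spike-off m≢p))
                                                                    (sumF-pair m (jumpAt φ) i j i≢j flat) ⟩
      (- w zero + - w zero) + (jumpAt φ i + jumpAt φ j) ≡⟨ cong ((- w zero + - w zero) +_) (cong₂ _+_ rise fall) ⟩
      (- w zero + - w zero) + ((- w (suc i) + - w (suc i)) + (w (suc j) + w (suc j))) ∎

-- ℕ's order is opened only here, where it cannot clash with the ring order.
open import Data.Nat using (_≤_)

-- The theorem.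
lemma4p7 : ∀ {c ℓ} (R : OrderedCommRing c ℓ) (k : ℕ) → 3 ≤ k →
    (w : Fin k → OrderedCommRing.Carrier R) →
    (∀ (x : Fin k → Sign) (s : Sign) → G0Is k x s →
      SgnIs R (sumF R k (λ i → OrderedCommRing._*_ R (w i) (L R k x i))) s) →
    (∀ (i : Fin k) → toℕ i ≡ 0 → OrderedCommRing._<_ R (w i) (OrderedCommRing.0# R))
    × (∀ (j : Fin k) → 1 ≤ toℕ j → OrderedCommRing._<_ R (OrderedCommRing.0# R) (w j))
    × (∀ (i j : Fin k) → 2 ≤ toℕ j → toℕ j ≡ suc (toℕ i) → OrderedCommRing._<_ R (w j) (w i))
lemma4p7 R zero    ()
lemma4p7 R (suc m) _ w represents = first , positive , decreasing
  where
  open OrderedCommRing R using (_<_; 0#)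
  open Weights R m w represents

  first : ∀ i → toℕ i ≡ 0 → w i < 0#
  first zero    _ = w₀-negative

  positive : ∀ j → 1 ≤ toℕ j → 0# < w j
  positive (suc j) _ = wⱼ-positive j

  decreasing : ∀ i j → 2 ≤ toℕ j → toℕ j ≡ suc (toℕ i) → w j < w i
  decreasing zero    (suc j) 2≤j j≡1  = contradiction (subst (2 ≤_) j≡1 2≤j) λ { (s≤s ()) }
  decreasing (suc i) (suc j) _   j≡i+2 = wⱼ-decreasing i j (ℕₚ.suc-injective j≡i+2)
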